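{- Let $r,t\geq3$ be integers and $R\in\tilde M_r(t)$. Suppose $u,v,w\in[t]$ are pairwise distinct and $f^R(u,v)\geq f^R(v,w)>m(r)$. Then $f^R(u,w)<m(r)$ and $\max\{f^R(u,v)f^R(u,w),\ f^R(v,w)f^R(u,w)\}\leq m(r)^2-1$.
   Context: $[r]=\{1,\ldots,r\}$, $m(r)=\lceil\frac{r+1}2\rceil$. An $r$-graph is a pair $R=(V,c)$ with $c:\binom V2\to 2^{[r]}$ (not necessarily with $|c(e)|=1$). A violating triple is $(i,j,k)\in\mathbb N^3$ for which $|i-j|\leq k\leq i+j$ fails. $\tilde M_r(t)$ is the set of $r$-graphs $R=([t],c)$ containing no violating triangle, i.e. there are no pairwise distinct $x,y,z$ and violating triple $(i,j,k)$ with $i\in c(xy)$, $j\in c(yz)$, $k\in c(xz)$. For $ij\in\binom{[t]}2$, $f^R(i,j)=\max\{|c(ij)|,1\}$. -}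

module Defs where

open import Data.Nat using (ℕ; suc; _≤_; _+_; _⊔_; ∣_-_∣; ⌈_/2⌉)
open import Data.Fin using (Fin; toℕ)
open import Data.Fin.Subset using (Subset; _∈_; ∣_∣)
open import Data.Product using (_×_)
open import Relation.Binary.PropositionalEquality using (_≡_; _≢_)

m : ℕ → ℕ
m r = ⌈ suc r /2⌉

-- The colour set [r] = {1,…,r} is encoded by Fin r: the element a : Fin r
-- stands for the colour toℕ a + 1.
colour : ∀ {r} → Fin r → ℕ
colour a = suc (toℕ a)

NonViolating : ℕ → ℕ → ℕ → Set
NonViolating i j k = ∣ i - j ∣ ≤ k × k ≤ i + j

-- An r-graph on vertex set [t] (encoded as Fin t): a colour-set assignment
-- to unordered pairs, represented as a symmetric function on ordered pairs
-- (its value on the diagonal is irrelevant).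
record RGraph (r t : ℕ) : Set where
  field
    c    : Fin t → Fin t → Subset r
    symm : ∀ x y → c x y ≡ c y x

open RGraph public

NoViolatingTriangle : ∀ {r t} → RGraph r t → Set
NoViolatingTriangle {r} {t} R =
  ∀ (x y z : Fin t) → x ≢ y → y ≢ z → x ≢ z →
  ∀ (i j k : Fin r) → i ∈ c R x y → j ∈ c R y z → k ∈ c R x z →
  NonViolating (colour i) (colour j) (colour k)

f : ∀ {r t} → RGraph r t → Fin t → Fin t → ℕ
f R x y = ∣ c R x y ∣ ⊔ 1

-- Write A, B, D for the colour sets of uv, vw, uw, and a, b, d for their
-- f-values; let i, j, k be the least colours in A, B, D. The triangle
-- condition confines A to [i, j + k] and D to [k, i + j], so a + d ≤ 2(j + 1),
-- while B ⊆ [j, r] and b > m(r) force j + 1 ≤ m(r). If D is empty then d = 1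
-- and a ≤ r give the same bound a + d ≤ 2m(r). Since a > m(r), this yields
-- d < m(r) and a·d ≤ m(r)² − 1, and b·d ≤ a·d.
module Submission where

open import Defs
open import Data.Nat using (ℕ; suc; _+_; _*_; _∸_; _⊔_; _≤_; _<_; z≤n; s≤s; ⌈_/2⌉; ⌊_/2⌋)
open import Data.Nat.Properties
open import Data.Nat.Tactic.RingSolver using (solve-∀)
open import Data.Fin using (Fin; toℕ; zero; suc)
open import Data.Fin.Properties using (toℕ<n)
open import Data.Fin.Subset using (Subset; inside; outside; _∈_; ∣_∣; Nonempty; Empty)
open import Data.Fin.Subset.Properties using (nonempty?; Empty-unique; ∣⊥∣≡0; ∣p∣≤n; x∈p⇒∣p-x∣<∣p∣)
open import Data.Vec.Base using ([]; _∷_; here; there)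
open import Data.Product using (∃; _×_; _,_; proj₁; proj₂)
open import Relation.Nullary using (yes; no; contradiction)
open import Relation.Binary.PropositionalEquality using (_≡_; _≢_; refl; sym; cong₂; subst)

m+n≤o+o⇒o<m⇒n<o : ∀ {m n o} → m + n ≤ o + o → o < m → n < o
m+n≤o+o⇒o<m⇒n<o {m} {n} {o} m+n≤o+o o<m = +-cancelˡ-≤ o _ _ (begin
  o + suc n  ≡⟨ +-suc o n ⟩
  suc o + n  ≤⟨ +-monoˡ-≤ n o<m ⟩
  m + n      ≤⟨ m+n≤o+o ⟩
  o + o      ∎)
  where open ≤-Reasoning

private
  1+o+e+n≡o+[n+1+e] : ∀ o e n → suc o + e + n ≡ o + (n + suc e)
  1+o+e+n≡o+[n+1+e] = solve-∀

-- Writing m = o + 1 + e and o = n + (1 + e) + k, the square o * o exceeds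
-- m * n by (1 + e)² + k² + 2k(1 + e) + n k.
m+n≤o+o⇒o<m⇒m*n<o*o : ∀ {m n o} → m + n ≤ o + o → o < m → m * n < o * o
m+n≤o+o⇒o<m⇒m*n<o*o {n = n} {o} m+n≤o+o o<m with e , refl ← m≤n⇒∃[o]m+o≡n o<m
  with k , refl ← m≤n⇒∃[o]m+o≡n (+-cancelˡ-≤ o _ _ (subst (_≤ o + o) (1+o+e+n≡o+[n+1+e] o e n) m+n≤o+o))
  = ≤-trans (m≤m+n _ _) (≤-reflexive (sym (square-expansion n e k)))
  where
  square-expansion : ∀ n e k →
    (n + suc e + k) * (n + suc e + k) ≡
    suc ((suc (n + suc e + k) + e) * n) + (e * e + 2 * e + k * k + 2 * k * suc e + n * k)
  square-expansion = solve-∀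

n<o+o⇒0<o : ∀ {n o} → n < o + o → 0 < o
n<o+o⇒0<o {o = suc _} _ = s≤s z≤n

∣S∣⊔1≡∣S∣ : ∀ {n} {S : Subset n} → Nonempty S → ∣ S ∣ ⊔ 1 ≡ ∣ S ∣
∣S∣⊔1≡∣S∣ (_ , x∈S) = m≥n⇒m⊔n≡m (≤-trans (s≤s z≤n) (x∈p⇒∣p-x∣<∣p∣ x∈S))

∣S∣⊔1≡1 : ∀ {n} {S : Subset n} → Empty S → ∣ S ∣ ⊔ 1 ≡ 1
∣S∣⊔1≡1 {n} S-empty rewrite Empty-unique S-empty | ∣⊥∣≡0 n = refl

1<∣S∣⊔1⇒nonempty : ∀ {n} {S : Subset n} → 1 < ∣ S ∣ ⊔ 1 → Nonempty S
1<∣S∣⊔1⇒nonempty {S = S} 1<∣S∣⊔1 with nonempty? S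
... | yes S-nonempty = S-nonempty
... | no  S-empty    = contradiction (∣S∣⊔1≡1 S-empty) (>⇒≢ 1<∣S∣⊔1)

-- The offset o is what makes the induction on S go through.
∣S∣+lo≤1+hi : ∀ {n} (S : Subset n) (o : ℕ) {lo hi} → lo ≤ suc hi →
  (∀ {k} → k ∈ S → lo ≤ o + toℕ k × o + toℕ k ≤ hi) → ∣ S ∣ + lo ≤ suc hi
∣S∣+lo≤1+hi []            o lo≤1+hi bounds = lo≤1+hi
∣S∣+lo≤1+hi (outside ∷ S) o {lo} {hi} lo≤1+hi bounds =
  ∣S∣+lo≤1+hi S (suc o) lo≤1+hi λ k∈S →
    subst (λ x → lo ≤ x × x ≤ hi) (+-suc o _) (bounds (there k∈S))
∣S∣+lo≤1+hi (inside ∷ S) o {lo} {hi} _ bounds = begin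
  suc (∣ S ∣ + lo)  ≤⟨ s≤s (+-monoʳ-≤ ∣ S ∣ lo≤o) ⟩
  suc (∣ S ∣ + o)   ≡⟨ +-suc ∣ S ∣ o ⟨
  ∣ S ∣ + suc o     ≤⟨ ∣S∣+lo≤1+hi S (suc o) (s≤s o≤hi) shifted-bounds ⟩
  suc hi            ∎
  where
  open ≤-Reasoning
  lo≤o : lo ≤ o
  lo≤o = subst (lo ≤_) (+-identityʳ o) (proj₁ (bounds here))
  o≤hi : o ≤ hi
  o≤hi = subst (_≤ hi) (+-identityʳ o) (proj₂ (bounds here))
  shifted-bounds : ∀ {k} → k ∈ S → suc o ≤ suc o + toℕ k × suc o + toℕ k ≤ hi
  shifted-bounds k∈S = m≤m+n (suc o) _ , subst (_≤ hi) (+-suc o _) (proj₂ (bounds (there k∈S)))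

Least : ∀ {n} → Subset n → Fin n → Set
Least S i = i ∈ S × (∀ {k} → k ∈ S → toℕ i ≤ toℕ k)

least : ∀ {n} {S : Subset n} → Nonempty S → ∃ (Least S)
least {S = inside  ∷ S} _                  = zero , here , λ _ → z≤n
least {S = outside ∷ S} (suc x , there x∈S) with i , i∈S , i≤ ← least (x , x∈S)
  = suc i , there i∈S , λ { (there k∈S) → s≤s (i≤ k∈S) }

∣S∣+colour[least]≤1+hi : ∀ {n} {S : Subset n} {i hi} → Least S i →
  (∀ {k} → k ∈ S → colour k ≤ hi) → ∣ S ∣ + colour i ≤ suc hi
∣S∣+colour[least]≤1+hi {S = S} (i∈S , i≤) ≤hi =
  ∣S∣+lo≤1+hi S 1 (≤-trans (≤hi i∈S) (n≤1+n _)) λ k∈S → s≤s (i≤ k∈S) , ≤hi k∈S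

windows⇒x+y≤2[1+q] : ∀ {x y p q s} → x + p ≤ suc (q + s) → y + s ≤ suc (p + q) →
  x + y ≤ suc q + suc q
windows⇒x+y≤2[1+q] {x} {y} {p} {q} {s} x-window y-window = +-cancelʳ-≤ (p + s) _ _ (begin
  x + y + (p + s)            ≡⟨ interchange x y p s ⟩
  (x + p) + (y + s)          ≤⟨ +-mono-≤ x-window y-window ⟩
  suc (q + s) + suc (p + q)  ≡⟨ regroup p q s ⟩
  suc q + suc q + (p + s)    ∎)
  where
  open ≤-Reasoning
  interchange : ∀ x y p s → x + y + (p + s) ≡ (x + p) + (y + s)
  interchange = solve-∀
  regroup : ∀ p q s → suc (q + s) + suc (p + q) ≡ suc q + suc q + (p + s)
  regroup = solve-∀

module _ {r t} (R : RGraph r t) (noViolation : NoViolatingTriangle R)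
         {u v w : Fin t} (u≢v : u ≢ v) (v≢w : v ≢ w) (u≢w : u ≢ w) where

  f[u,v]+f[u,w]≤M+M : ∀ {M} → r < M + M → M < f R u v → M < f R v w →
    f R u v + f R u w ≤ M + M
  f[u,v]+f[u,w]≤M+M {M} r<M+M M<f[u,v] M<f[v,w] with nonempty? (c R u w)
  ... | no D-empty = begin
    f R u v + f R u w  ≡⟨ cong₂ _+_ (∣S∣⊔1≡∣S∣ A-nonempty) (∣S∣⊔1≡1 D-empty) ⟩
    ∣ c R u v ∣ + 1    ≤⟨ +-monoˡ-≤ 1 (∣p∣≤n (c R u v)) ⟩
    r + 1              ≡⟨ +-comm r 1 ⟩
    suc r              ≤⟨ r<M+M ⟩
    M + M              ∎
    where
    open ≤-Reasoning
    A-nonempty : Nonempty (c R u v)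
    A-nonempty = 1<∣S∣⊔1⇒nonempty (≤-trans (s≤s (n<o+o⇒0<o r<M+M)) M<f[u,v])
  ... | yes D-nonempty = begin
    f R u v + f R u w                  ≡⟨ cong₂ _+_ (∣S∣⊔1≡∣S∣ A-nonempty) (∣S∣⊔1≡∣S∣ D-nonempty) ⟩
    ∣ c R u v ∣ + ∣ c R u w ∣          ≤⟨ windows⇒x+y≤2[1+q] {q = colour j} A-window D-window ⟩
    suc (colour j) + suc (colour j)    ≤⟨ +-mono-≤ 1+j≤M 1+j≤M ⟩
    M + M                              ∎
    where
    open ≤-Reasoning
    0<M : 0 < M
    0<M = n<o+o⇒0<o r<M+M
    A-nonempty : Nonempty (c R u v)
    A-nonempty = 1<∣S∣⊔1⇒nonempty (≤-trans (s≤s 0<M) M<f[u,v])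
    B-nonempty : Nonempty (c R v w)
    B-nonempty = 1<∣S∣⊔1⇒nonempty (≤-trans (s≤s 0<M) M<f[v,w])
    i j k : Fin r
    i = proj₁ (least A-nonempty)
    j = proj₁ (least B-nonempty)
    k = proj₁ (least D-nonempty)
    i-least : Least (c R u v) i
    i-least = proj₂ (least A-nonempty)
    j-least : Least (c R v w) j
    j-least = proj₂ (least B-nonempty)
    k-least : Least (c R u w) k
    k-least = proj₂ (least D-nonempty)
    triangle : ∀ i j k → i ∈ c R u v → j ∈ c R v w → k ∈ c R u w →
               NonViolating (colour i) (colour j) (colour k)
    triangle = noViolation u v w u≢v v≢w u≢w
    A-window : ∣ c R u v ∣ + colour i ≤ suc (colour j + colour k)
    A-window = ∣S∣+colour[least]≤1+hi i-least λ {i′} i′∈A →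
      ≤-trans (m≤n+∣m-n∣ (colour i′) (colour j))
              (+-monoʳ-≤ (colour j) (proj₁ (triangle i′ j k i′∈A (proj₁ j-least) (proj₁ k-least))))
    D-window : ∣ c R u w ∣ + colour k ≤ suc (colour i + colour j)
    D-window = ∣S∣+colour[least]≤1+hi k-least λ k′∈D →
      proj₂ (triangle i j _ (proj₁ i-least) (proj₁ j-least) k′∈D)
    B-window : ∣ c R v w ∣ + colour j ≤ suc r
    B-window = ∣S∣+colour[least]≤1+hi j-least λ {j′} _ → toℕ<n j′
    1+j≤M : suc (colour j) ≤ M
    1+j≤M = m+n≤o+o⇒o<m⇒n<o (≤-trans B-window r<M+M)
                            (subst (M <_) (∣S∣⊔1≡∣S∣ B-nonempty) M<f[v,w])

1+r≤m[r]+m[r] : ∀ r → suc r ≤ m r + m r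
1+r≤m[r]+m[r] r = begin
  suc r                      ≡⟨ ⌊n/2⌋+⌈n/2⌉≡n (suc r) ⟨
  ⌊ suc r /2⌋ + ⌈ suc r /2⌉  ≤⟨ +-monoˡ-≤ (m r) (⌊n/2⌋≤⌈n/2⌉ (suc r)) ⟩
  m r + m r                  ∎
  where open ≤-Reasoning

corollary4p10 : (r t : ℕ) → 3 ≤ r → 3 ≤ t →
    (R : RGraph r t) → NoViolatingTriangle R →
    (u v w : Fin t) → u ≢ v → v ≢ w → u ≢ w →
    f R v w ≤ f R u v → m r < f R v w →
    (f R u w < m r) ×
    ((f R u v * f R u w) ⊔ (f R v w * f R u w) ≤ m r * m r ∸ 1)
corollary4p10 r t _ _ R noViolation u v w u≢v v≢w u≢w f[v,w]≤f[u,v] m<f[v,w] =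
  m+n≤o+o⇒o<m⇒n<o a+d≤2m m<f[u,v] ,
  ⊔-lub a*d≤m*m∸1 (≤-trans (*-monoˡ-≤ (f R u w) f[v,w]≤f[u,v]) a*d≤m*m∸1)
  where
  m<f[u,v] : m r < f R u v
  m<f[u,v] = <-≤-trans m<f[v,w] f[v,w]≤f[u,v]
  a+d≤2m : f R u v + f R u w ≤ m r + m r
  a+d≤2m = f[u,v]+f[u,w]≤M+M R noViolation u≢v v≢w u≢w (1+r≤m[r]+m[r] r) m<f[u,v] m<f[v,w]
  a*d≤m*m∸1 : f R u v * f R u w ≤ m r * m r ∸ 1
  a*d≤m*m∸1 = m+n≤o⇒m≤o∸n _ (subst (_≤ m r * m r) (+-comm 1 _) (m+n≤o+o⇒o<m⇒m*n<o*o a+d≤2m m<f[u,v]))
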